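{- Let $(X,\leq,\top,\ominus)$ be a D-poset with canonical sum $\oplus$. For $m\geq 0$ let $C_m$ be the set of monotone functions $[2m]\to X$ ($[m]=\{0<\dots<m\}$). For $n\geq 0$ and $k\geq 1$ define $s_n,t_n:C_{n+k}\to C_n$ by $s_n(f)(i)=f(i)$ for $0\leq i\leq n$, $s_n(f)(i)=f(i+2k)$ for $n<i\leq 2n$; $t_n(f)(i)=f(i)$ for $0\leq i<n$, $t_n(f)(i)=f(i+2k)$ for $n\leq i\leq 2n$. For $f,g\in C_{n+k}$ with $s_n(f)=t_n(g)$ define \[c_n(f,g)(i)=\begin{cases} g(i) & 0\leq i\leq n\\ (f(i)\ominus f(n))\oplus g(i) & n<i<n+2k\\ f(i) & n+2k\leq i\leq 2n+2k.\end{cases}\] Then whenever $s_n(f)=t_n(g)$, the expression $c_n(f,g)(i)$ is defined for every $i$ and $c_n(f,g)$ is a monotone function $[2n+2k]\to X$, i.e. $c_n(f,g)\in C_{n+k}$.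
   Context: A D-poset $(X,\leq,\top,\ominus)$ is a poset with top element $\top$ and a partial binary operation $\ominus$ such that: (1) $y\ominus x$ is defined precisely when $x\leq y$; (2) whenever $x\leq y$, $y\ominus x\leq y$ and $y\ominus(y\ominus x)=x$; (3) if $z\leq y\leq x$ then $x\ominus y\leq x\ominus z$ and $(x\ominus z)\ominus(x\ominus y)=y\ominus z$. The canonical sum: $a\oplus b$ is defined iff there is $c$ with $c\ominus b=a$ (equivalently iff $b\leq\top\ominus a$), and then $a\oplus b:=c$. -}

module Defs where

open import Level using (Level; _⊔_) renaming (suc to lsuc)
open import Data.Nat using (ℕ; zero; suc; _+_; _*_; _≤_; _<_; _≤?_; _<?_; s≤s; z≤n)
open import Data.Nat.Properties using (+-monoˡ-<; *-distribˡ-+; +-suc; ≤-trans; m≤m+n; ≤-refl)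
open import Data.Fin as Fin using (Fin; toℕ; fromℕ<)
open import Data.Fin.Properties using (toℕ<n)
open import Data.Product using (Σ; _×_; _,_; ∃)
open import Relation.Nullary using (yes; no)
open import Relation.Binary using (Rel; IsPartialOrder)
open import Relation.Binary.PropositionalEquality using (_≡_; subst; sym; cong)

-- The partial operation y ⊖ x is modelled as a
-- function taking a proof of x ≤ y as an irrelevant argument, so it is
-- defined exactly when x ≤ y (axiom (1)) and does not depend on the proof.
record DPoset (c ℓ : Level) : Set (lsuc (c ⊔ ℓ)) where
  field
    Carrier        : Set c
    _≤ₓ_           : Rel Carrier ℓ
    isPartialOrder : IsPartialOrder _≡_ _≤ₓ_
    ⊤              : Carrier
    ⊤-max          : ∀ x → x ≤ₓ ⊤
    diff           : (y x : Carrier) → .(x ≤ₓ y) → Carrier   -- diff y x p = y ⊖ x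
  open IsPartialOrder isPartialOrder public using (refl; trans; antisym)
  field
    diff-≤   : ∀ {x y} .(p : x ≤ₓ y) → diff y x p ≤ₓ y
    diff-inv : ∀ {x y} .(p : x ≤ₓ y) → diff y (diff y x p) (diff-≤ p) ≡ x
    diff-anti  : ∀ {x y z} .(zy : z ≤ₓ y) .(yx : y ≤ₓ x) →
                 diff x y yx ≤ₓ diff x z (trans zy yx)
    diff-assoc : ∀ {x y z} .(zy : z ≤ₓ y) .(yx : y ≤ₓ x) →
                 diff (diff x z (trans zy yx)) (diff x y yx) (diff-anti zy yx) ≡ diff y z zy

  -- Canonical sum: a ⊕ b is defined iff there is c with c ⊖ b = a, and then
  -- a ⊕ b = c.  `IsSum a b c` says "a ⊕ b is defined and equals c".
  IsSum : Carrier → Carrier → Carrier → Set (c ⊔ ℓ)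
  IsSum a b z = Σ (b ≤ₓ z) λ p → diff z b p ≡ a

  Monotone : ∀ {N} → (Fin (suc N) → Carrier) → Set ℓ
  Monotone {N} f = ∀ (i j : Fin (suc N)) → toℕ i ≤ toℕ j → f i ≤ₓ f j

  C : ℕ → Set (c ⊔ ℓ)
  C m = Σ (Fin (suc (2 * m)) → Carrier) Monotone

idx : (N j : ℕ) → j ≤ N → Fin (suc N)
idx N j p = fromℕ< (s≤s p)

private
  up-bound : ∀ n k (i : Fin (suc (2 * n))) → toℕ i + 2 * k ≤ 2 * (n + k)
  up-bound n k i = subst (toℕ i + 2 * k ≤_) (sym (*-distribˡ-+ 2 n k))
    (+-monoˡ-≤′ (toℕ i) (2 * n) (2 * k) (Data.Nat.Properties.≤-pred (toℕ<n i)))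
    where
    +-monoˡ-≤′ : ∀ a b c → a ≤ b → a + c ≤ b + c
    +-monoˡ-≤′ a b c p = Data.Nat.Properties.+-monoˡ-≤ c p

  low-bound : ∀ n k (i : Fin (suc (2 * n))) → toℕ i ≤ 2 * (n + k)
  low-bound n k i = ≤-trans (m≤m+n (toℕ i) (2 * k)) (up-bound n k i)

module _ {c ℓ} (D : DPoset c ℓ) where
  open DPoset D

  s : (n k : ℕ) → (Fin (suc (2 * (n + k))) → Carrier) → Fin (suc (2 * n)) → Carrier
  s n k f i with toℕ i ≤? n
  ... | yes _ = f (idx _ (toℕ i) (low-bound n k i))
  ... | no  _ = f (idx _ (toℕ i + 2 * k) (up-bound n k i))

  t : (n k : ℕ) → (Fin (suc (2 * (n + k))) → Carrier) → Fin (suc (2 * n)) → Carrier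
  t n k f i with toℕ i <? n
  ... | yes _ = f (idx _ (toℕ i) (low-bound n k i))
  ... | no  _ = f (idx _ (toℕ i + 2 * k) (up-bound n k i))

  nIdx : (n k : ℕ) → Fin (suc (2 * (n + k)))
  nIdx n k = idx _ n (≤-trans (m≤m+n n k) (m≤m+n (n + k) (n + k + 0)))

  nIdx-≤ : ∀ n k (i : Fin (suc (2 * (n + k)))) → n < toℕ i → toℕ (nIdx n k) ≤ toℕ i
  nIdx-≤ n k i p = subst (_≤ toℕ i) (sym (Data.Fin.Properties.toℕ-fromℕ< _))
                     (Data.Nat.Properties.<⇒≤ p)

-- In terms of the complement x ᶜ = ⊤ ⊖ x, the canonical sum is a ⊕ b = (b ᶜ ⊖ a) ᶜ,
-- defined when a ≤ b ᶜ, and it is monotone in both arguments.  The hypothesis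
-- s_n(f) = t_n(g), read at index n, says f(n) = g(n+2k).  So on the middle segment
-- g(i) ≤ g(n+2k) = f(n) gives f(i) ⊖ f(n) ≤ f(n) ᶜ ≤ g(i) ᶜ, and the sum exists;
-- monotonicity across the two seams follows from g(i) ≤ (f(i) ⊖ f(n)) ⊕ g(i) and
-- (f(i) ⊖ f(n)) ⊕ g(i) ≤ (f(i) ⊖ f(n)) ⊕ f(n) = f(i).
module Submission where

open import Defs
open import Level using (Level)
open import Data.Nat using (ℕ; suc; _+_; _*_; _≤_; _<_; _≤?_; _<?_)
open import Data.Nat.Properties
  using (≤-reflexive; ≤-trans; <⇒≤; <⇒≱; ≰⇒>; ≮⇒≥; m≤m+n; m<m+n; +-monoˡ-≤; *-distribˡ-+; <-≤-trans)
open import Data.Fin using (Fin; toℕ)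
open import Data.Fin.Properties using (toℕ-injective; toℕ-fromℕ<)
open import Data.Product using (Σ; _×_; proj₁; proj₂; _,_)
open import Data.Empty using (⊥-elim)
open import Relation.Nullary using (yes; no)
open import Relation.Binary.PropositionalEquality
  using (_≡_; refl; sym; cong; subst; subst₂; module ≡-Reasoning)
import Relation.Binary.PropositionalEquality as ≡

module DPosetProperties {c ℓ} (D : DPoset c ℓ) where
  open DPoset D hiding (refl)
  open ≡-Reasoning

  diff-cong : ∀ {y y′ x x′} → y ≡ y′ → x ≡ x′ →
              .(p : x ≤ₓ y) .(p′ : x′ ≤ₓ y′) → diff y x p ≡ diff y′ x′ p′
  diff-cong refl refl _ _ = refl

  diff-monoˡ-≤ : ∀ {x y z} .(z≤x : z ≤ₓ x) .(x≤y : x ≤ₓ y) →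
                 diff x z z≤x ≤ₓ diff y z (trans z≤x x≤y)
  diff-monoˡ-≤ {y = y} {z} z≤x x≤y =
    subst (_≤ₓ diff y z (trans z≤x x≤y)) (diff-assoc z≤x x≤y) (diff-≤ (diff-anti z≤x x≤y))

  infixl 30 _ᶜ
  infix 25 _⊕_⟨_⟩

  _ᶜ : Carrier → Carrier
  x ᶜ = diff ⊤ x (⊤-max x)

  ᶜ-involutive : ∀ x → x ᶜ ᶜ ≡ x
  ᶜ-involutive x = diff-inv (⊤-max x)

  ᶜ-antitone : ∀ {x y} → x ≤ₓ y → y ᶜ ≤ₓ x ᶜ
  ᶜ-antitone {y = y} x≤y = diff-anti x≤y (⊤-max y)

  ᶜ-cancel-≤ : ∀ {x y} → x ᶜ ≤ₓ y ᶜ → y ≤ₓ x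
  ᶜ-cancel-≤ {x} {y} xᶜ≤yᶜ =
    subst₂ _≤ₓ_ (ᶜ-involutive y) (ᶜ-involutive x) (ᶜ-antitone xᶜ≤yᶜ)

  diff≤ᶜ : ∀ {x z} .(z≤x : z ≤ₓ x) → diff x z z≤x ≤ₓ z ᶜ
  diff≤ᶜ {x} z≤x = diff-monoˡ-≤ z≤x (⊤-max x)

  _⊕_⟨_⟩ : (a b : Carrier) → .(a ≤ₓ b ᶜ) → Carrier
  a ⊕ b ⟨ a≤bᶜ ⟩ = diff (b ᶜ) a a≤bᶜ ᶜ

  ⊕-isSum : ∀ {a b} .(a≤bᶜ : a ≤ₓ b ᶜ) → IsSum a b (a ⊕ b ⟨ a≤bᶜ ⟩)
  ⊕-isSum {a} {b} a≤bᶜ = b≤sum , (begin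
      diff sum b b≤sum          ≡⟨ diff-assoc b≤sum (⊤-max sum) ⟨
      diff (b ᶜ) (sum ᶜ) _      ≡⟨ diff-cong refl (ᶜ-involutive rest) _ (diff-≤ a≤bᶜ) ⟩
      diff (b ᶜ) rest _         ≡⟨ diff-inv a≤bᶜ ⟩
      a                         ∎)
    where
    rest = diff (b ᶜ) a a≤bᶜ
    sum  = rest ᶜ
    b≤sum : b ≤ₓ sum
    b≤sum = ᶜ-cancel-≤ (subst (_≤ₓ b ᶜ) (sym (ᶜ-involutive rest)) (diff-≤ a≤bᶜ))

  ⊕-mono-≤ : ∀ {a a′ b b′} → a ≤ₓ a′ → b ≤ₓ b′ →
             .(a≤bᶜ : a ≤ₓ b ᶜ) (a′≤b′ᶜ : a′ ≤ₓ b′ ᶜ) →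
             a ⊕ b ⟨ a≤bᶜ ⟩ ≤ₓ a′ ⊕ b′ ⟨ a′≤b′ᶜ ⟩
  ⊕-mono-≤ a≤a′ b≤b′ _ a′≤b′ᶜ = ᶜ-antitone (trans
    (diff-anti a≤a′ a′≤b′ᶜ)
    (diff-monoˡ-≤ (trans a≤a′ a′≤b′ᶜ) (ᶜ-antitone b≤b′)))

  diff-⊕-cancel : ∀ {x z} .(z≤x : z ≤ₓ x) .(p : diff x z z≤x ≤ₓ z ᶜ) →
                  diff x z z≤x ⊕ z ⟨ p ⟩ ≡ x
  diff-⊕-cancel {x} {z} z≤x p = begin
    diff (z ᶜ) (diff x z z≤x) p ᶜ
      ≡⟨ cong _ᶜ (diff-cong refl (diff-assoc z≤x (⊤-max x)) (diff-≤ xᶜ≤zᶜ) p) ⟨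
    diff (z ᶜ) (diff (z ᶜ) (x ᶜ) xᶜ≤zᶜ) (diff-≤ xᶜ≤zᶜ) ᶜ
      ≡⟨ cong _ᶜ (diff-inv xᶜ≤zᶜ) ⟩
    x ᶜ ᶜ
      ≡⟨ ᶜ-involutive x ⟩
    x ∎
    where
    xᶜ≤zᶜ : x ᶜ ≤ₓ z ᶜ
    xᶜ≤zᶜ = diff-anti z≤x (⊤-max x)

-- Glue G (up to index a) and F (from index b on) along F p = G q, filling the
-- segment a < i < b with (F i ⊖ F p) ⊕ G i.
module Gluing {c ℓ} (D : DPoset c ℓ) {N : ℕ} (F G : Fin (suc N) → DPoset.Carrier D)
    (F-mono : DPoset.Monotone D F) (G-mono : DPoset.Monotone D G)
    {a b : ℕ} (a<b : a < b) (p q : Fin (suc N)) (p≡a : toℕ p ≡ a) (q≡b : toℕ q ≡ b)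
    (Fp≡Gq : F p ≡ G q) where
  open DPoset D renaming (refl to ≤ₓ-refl)
  open DPosetProperties D

  G≤Fp : ∀ i → toℕ i ≤ b → G i ≤ₓ F p
  G≤Fp i i≤b = subst (G i ≤ₓ_) (sym Fp≡Gq) (G-mono i q (subst (toℕ i ≤_) (sym q≡b) i≤b))

  Fp≤F : ∀ i → a ≤ toℕ i → F p ≤ₓ F i
  Fp≤F i a≤i = F-mono p i (subst (_≤ toℕ i) (sym p≡a) a≤i)

  excess : ∀ i → a ≤ toℕ i → Carrier
  excess i a≤i = diff (F i) (F p) (Fp≤F i a≤i)

  excess≤Gᶜ : ∀ i (a≤i : a ≤ toℕ i) → toℕ i ≤ b → excess i a≤i ≤ₓ G i ᶜ
  excess≤Gᶜ i a≤i i≤b = trans (diff≤ᶜ (Fp≤F i a≤i)) (ᶜ-antitone (G≤Fp i i≤b))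

  excess-mono : ∀ i j (a≤i : a ≤ toℕ i) (a≤j : a ≤ toℕ j) → toℕ i ≤ toℕ j →
                excess i a≤i ≤ₓ excess j a≤j
  excess-mono i j a≤i _ i≤j = diff-monoˡ-≤ (Fp≤F i a≤i) (F-mono i j i≤j)

  data Region (m : ℕ) : Set where
    below  : m ≤ a → Region m
    inside : a < m → m < b → Region m
    above  : b ≤ m → Region m

  region : ∀ m → Region m
  region m with m ≤? a
  ... | yes m≤a = below m≤a
  ... | no m≰a with m <? b
  ...   | yes m<b = inside (≰⇒> m≰a) m<b
  ...   | no m≮b  = above (≮⇒≥ m≮b)

  glue : Fin (suc N) → Carrier
  glue i with region (toℕ i)
  ... | below _        = G i
  ... | inside a<i i<b = excess i (<⇒≤ a<i) ⊕ G i ⟨ excess≤Gᶜ i (<⇒≤ a<i) (<⇒≤ i<b) ⟩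
  ... | above _        = F i

  glue-below : ∀ i → toℕ i ≤ a → glue i ≡ G i
  glue-below i i≤a with region (toℕ i)
  ... | below _       = refl
  ... | inside a<i _  = ⊥-elim (<⇒≱ a<i i≤a)
  ... | above b≤i     = ⊥-elim (<⇒≱ (<-≤-trans a<b b≤i) i≤a)

  glue-inside : ∀ i (a<i : a < toℕ i) → toℕ i < b → IsSum (excess i (<⇒≤ a<i)) (G i) (glue i)
  glue-inside i a<i i<b with region (toℕ i)
  ... | below i≤a     = ⊥-elim (<⇒≱ a<i i≤a)
  ... | inside _ _    = ⊕-isSum (excess≤Gᶜ i (<⇒≤ a<i) (<⇒≤ i<b))
  ... | above b≤i     = ⊥-elim (<⇒≱ i<b b≤i)

  glue-above : ∀ i → b ≤ toℕ i → glue i ≡ F i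
  glue-above i b≤i with region (toℕ i)
  ... | below i≤a     = ⊥-elim (<⇒≱ (<-≤-trans a<b b≤i) i≤a)
  ... | inside _ i<b  = ⊥-elim (<⇒≱ i<b b≤i)
  ... | above _       = refl

  glue-monotone : Monotone glue
  glue-monotone i j i≤j with region (toℕ i) | region (toℕ j)
  ... | below _ | below _ = G-mono i j i≤j
  ... | below _ | inside a<j j<b =
    trans (G-mono i j i≤j) (proj₁ (⊕-isSum (excess≤Gᶜ j (<⇒≤ a<j) (<⇒≤ j<b))))
  ... | below i≤a | above b≤j =
    trans (G≤Fp i (≤-trans i≤a (<⇒≤ a<b))) (Fp≤F j (≤-trans (<⇒≤ a<b) b≤j))
  ... | inside a<i _ | below j≤a = ⊥-elim (<⇒≱ a<i (≤-trans i≤j j≤a))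
  ... | inside a<i i<b | inside a<j j<b =
    ⊕-mono-≤ (excess-mono i j (<⇒≤ a<i) (<⇒≤ a<j) i≤j) (G-mono i j i≤j)
      (excess≤Gᶜ i (<⇒≤ a<i) (<⇒≤ i<b)) (excess≤Gᶜ j (<⇒≤ a<j) (<⇒≤ j<b))
  ... | inside a<i i<b | above _ =
    trans (⊕-mono-≤ ≤ₓ-refl (G≤Fp i (<⇒≤ i<b)) (excess≤Gᶜ i (<⇒≤ a<i) (<⇒≤ i<b))
                    (diff≤ᶜ (Fp≤F i (<⇒≤ a<i))))
          (subst (_≤ₓ F j) (sym (diff-⊕-cancel (Fp≤F i (<⇒≤ a<i)) (diff≤ᶜ (Fp≤F i (<⇒≤ a<i)))))
                 (F-mono i j i≤j))
  ... | above b≤i | below j≤a = ⊥-elim (<⇒≱ (<-≤-trans a<b (≤-trans b≤i i≤j)) j≤a)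
  ... | above b≤i | inside _ j<b = ⊥-elim (<⇒≱ j<b (≤-trans b≤i i≤j))
  ... | above _ | above _ = F-mono i j i≤j

m+2n≤2[m+n] : ∀ m n → m + 2 * n ≤ 2 * (m + n)
m+2n≤2[m+n] m n = subst (m + 2 * n ≤_) (sym (*-distribˡ-+ 2 m n))
                    (+-monoˡ-≤ (2 * n) (m≤m+n m (m + 0)))

module _ {c ℓ} (D : DPoset c ℓ) (n k : ℕ) where
  open DPoset D using (Carrier)

  s-below : ∀ (H : Fin (suc (2 * (n + k))) → Carrier) i j →
            toℕ i ≤ n → toℕ j ≡ toℕ i → s D n k H i ≡ H j
  s-below H i j i≤n j≡i with toℕ i ≤? n
  ... | yes _  = cong H (toℕ-injective (≡.trans (toℕ-fromℕ< _) (sym j≡i)))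
  ... | no i≰n = ⊥-elim (i≰n i≤n)

  t-above : ∀ (H : Fin (suc (2 * (n + k))) → Carrier) i j →
            n ≤ toℕ i → toℕ j ≡ toℕ i + 2 * k → t D n k H i ≡ H j
  t-above H i j n≤i j≡i+2k with toℕ i <? n
  ... | yes i<n = ⊥-elim (<⇒≱ i<n n≤i)
  ... | no _    = cong H (toℕ-injective (≡.trans (toℕ-fromℕ< _) (sym j≡i+2k)))

  s≗t⇒f[n]≡g[n+2k] : (F G : Fin (suc (2 * (n + k))) → Carrier) →
    (∀ i → s D n k F i ≡ t D n k G i) →
    F (nIdx D n k) ≡ G (idx _ (n + 2 * k) (m+2n≤2[m+n] n k))
  s≗t⇒f[n]≡g[n+2k] F G s≗t = begin
    F (nIdx D n k)  ≡⟨ s-below F n′ _ (≤-reflexive n′≡n)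
                                     (≡.trans (toℕ-fromℕ< _) (sym n′≡n)) ⟨
    s D n k F n′    ≡⟨ s≗t n′ ⟩
    t D n k G n′    ≡⟨ t-above G n′ _ (≤-reflexive (sym n′≡n))
                                     (≡.trans (toℕ-fromℕ< _) (cong (_+ 2 * k) (sym n′≡n))) ⟩
    G _             ∎
    where
    open ≡-Reasoning
    n′ : Fin (suc (2 * n))
    n′ = idx (2 * n) n (m≤m+n n (n + 0))
    n′≡n : toℕ n′ ≡ n
    n′≡n = toℕ-fromℕ< _

mainTheorem10 : ∀ {c ℓ : Level} (D : DPoset c ℓ) (n k : ℕ) → 1 ≤ k →
    (f g : DPoset.C D (n + k)) →
    (∀ (i : Fin (Data.Nat.suc (2 * n))) → s D n k (proj₁ f) i ≡ t D n k (proj₁ g) i) →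
    Σ (Fin (Data.Nat.suc (2 * (n + k))) → DPoset.Carrier D) λ h →
      (∀ i → toℕ i ≤ n → h i ≡ proj₁ g i)
      × (∀ i → (lo : n < toℕ i) → toℕ i < n + 2 * k →
           DPoset.IsSum D
             (DPoset.diff D (proj₁ f i) (proj₁ f (nIdx D n k))
               (proj₂ f (nIdx D n k) i (nIdx-≤ D n k i lo)))
             (proj₁ g i) (h i))
      × (∀ i → n + 2 * k ≤ toℕ i → h i ≡ proj₁ f i)
      × DPoset.Monotone D h
mainTheorem10 D n k 1≤k (F , F-mono) (G , G-mono) s≗t =
  glue , glue-below , glue-inside , glue-above , glue-monotone
  where
  open Gluing D F G F-mono G-mono (m<m+n n (≤-trans 1≤k (m≤m+n k (k + 0))))
    (nIdx D n k) (idx _ (n + 2 * k) (m+2n≤2[m+n] n k)) (toℕ-fromℕ< _) (toℕ-fromℕ< _)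
    (s≗t⇒f[n]≡g[n+2k] D n k F G s≗t)
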